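{- Let $\bar p=p_1,\dots,p_m$. If $\phi(\bar p,\bar r)\to\psi(\bar p,\bar s)$ is a classical tautology, then (1) $\mathsf{IPC}\vdash\bigwedge_i(p_i\vee\neg p_i)\to(\neg\phi(\bar p,\bar r)\vee\neg\neg\psi(\bar p,\bar s))$, and (2) $\mathsf{K}\vdash\bigwedge_i(\Box p_i\vee\Box\neg p_i)\to(\Box\neg\phi(\bar p,\bar r)\vee\Box\psi(\bar p,\bar s))$. If moreover either $\phi(\bar p,\bar r)$ or $\psi(\bar p,\bar s)$ is monotone in $\bar p$, then, for a tuple $\bar q=q_1,\dots,q_m$ of fresh atoms, (3) $\mathsf{IPC}\vdash\bigwedge_i(p_i\vee q_i)\to(\neg\phi(\neg\bar p,\bar r)\vee\neg\neg\psi(\bar q,\bar s))$, and (4) $\mathsf{K}\vdash\bigwedge_i(\Box p_i\vee\Box q_i)\to(\Box\neg\phi(\neg\bar p,\bar r)\vee\Box\psi(\bar q,\bar s))$.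
   Context: Formulas are over $\{\top,\bot,\wedge,\vee,\to\}$ with $\neg\chi:=\chi\to\bot$. A formula is monotone in a set of atoms $P$ if no $\neg p$ with $p\in P$ occurs in its classical negation normal form. $\phi(\neg\bar p,\bar r)$ denotes the result of substituting $\neg p_i$ for $p_i$. $\mathsf{K}$ is the minimal normal modal logic. -}

module Defs where

open import Data.Nat using (ℕ; _≟_)
open import Data.Bool using (Bool; true; false; _∧_; _∨_; not; if_then_else_)
open import Data.List using (List; []; _∷_; _++_)
open import Data.Vec using (Vec; []; _∷_; map)
open import Data.Vec.Membership.Propositional renaming (_∈_ to _∈ᵥ_)
open import Data.List.Membership.Propositional using (_∈_)
open import Relation.Nullary using (¬_; does)
open import Relation.Binary.PropositionalEquality using (_≡_)
open import Data.Product using (_×_)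

infixr 6 _∧'_
infixr 5 _∨'_
infixr 4 _⇒_

data Fm : Set where
  var  : ℕ → Fm
  ⊤'   : Fm
  ⊥'   : Fm
  _∧'_ : Fm → Fm → Fm
  _∨'_ : Fm → Fm → Fm
  _⇒_  : Fm → Fm → Fm

∼_ : Fm → Fm
∼ χ = χ ⇒ ⊥'

atoms : Fm → List ℕ
atoms (var x)  = x ∷ []
atoms ⊤'       = []
atoms ⊥'       = []
atoms (a ∧' b) = atoms a ++ atoms b
atoms (a ∨' b) = atoms a ++ atoms b
atoms (a ⇒ b)  = atoms a ++ atoms b

eval : (ℕ → Bool) → Fm → Bool
eval v (var x)  = v x
eval v ⊤'       = true
eval v ⊥'       = false
eval v (a ∧' b) = eval v a ∧ eval v b
eval v (a ∨' b) = eval v a ∨ eval v b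
eval v (a ⇒ b)  = not (eval v a) ∨ eval v b

Tautology : Fm → Set
Tautology φ = (v : ℕ → Bool) → eval v φ ≡ true

sub : (ℕ → Fm) → Fm → Fm
sub σ (var x)  = σ x
sub σ ⊤'       = ⊤'
sub σ ⊥'       = ⊥'
sub σ (a ∧' b) = sub σ a ∧' sub σ b
sub σ (a ∨' b) = sub σ a ∨' sub σ b
sub σ (a ⇒ b)  = sub σ a ⇒ sub σ b

assign : ∀ {m} → Vec ℕ m → Vec Fm m → ℕ → Fm
assign []       []       x = var x
assign (p ∷ ps) (χ ∷ χs) x = if does (x ≟ p) then χ else assign ps χs x

negSub : ∀ {m} → Vec ℕ m → Fm → Fm
negSub ps = sub (assign ps (map (λ p → ∼ var p) ps))

renSub : ∀ {m} → Vec ℕ m → Vec ℕ m → Fm → Fm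
renSub ps qs = sub (assign ps (map var qs))

data NNF : Set where
  pos  : ℕ → NNF
  neg  : ℕ → NNF
  ⊤ₙ   : NNF
  ⊥ₙ   : NNF
  _∧ₙ_ : NNF → NNF → NNF
  _∨ₙ_ : NNF → NNF → NNF

-- nnf true φ is the classical NNF of φ, nnf false φ that of ¬φ
nnf : Bool → Fm → NNF
nnf true  (var x)  = pos x
nnf false (var x)  = neg x
nnf true  ⊤'       = ⊤ₙ
nnf false ⊤'       = ⊥ₙ
nnf true  ⊥'       = ⊥ₙ
nnf false ⊥'       = ⊤ₙ
nnf true  (a ∧' b) = nnf true a ∧ₙ nnf true b
nnf false (a ∧' b) = nnf false a ∨ₙ nnf false b
nnf true  (a ∨' b) = nnf true a ∨ₙ nnf true b
nnf false (a ∨' b) = nnf false a ∧ₙ nnf false b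
nnf true  (a ⇒ b)  = nnf false a ∨ₙ nnf true b
nnf false (a ⇒ b)  = nnf true a ∧ₙ nnf false b

data NegOcc (p : ℕ) : NNF → Set where
  here : NegOcc p (neg p)
  ∧ˡ : ∀ {a b} → NegOcc p a → NegOcc p (a ∧ₙ b)
  ∧ʳ : ∀ {a b} → NegOcc p b → NegOcc p (a ∧ₙ b)
  ∨ˡ : ∀ {a b} → NegOcc p a → NegOcc p (a ∨ₙ b)
  ∨ʳ : ∀ {a b} → NegOcc p b → NegOcc p (a ∨ₙ b)

Monotone : ∀ {m} → Vec ℕ m → Fm → Set
Monotone P φ = ∀ p → p ∈ᵥ P → ¬ NegOcc p (nnf true φ)

data IPC⊢_ : Fm → Set where
  ax-K   : ∀ {a b}   → IPC⊢ (a ⇒ b ⇒ a)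
  ax-S   : ∀ {a b c} → IPC⊢ ((a ⇒ b ⇒ c) ⇒ (a ⇒ b) ⇒ a ⇒ c)
  ax-∧₁  : ∀ {a b}   → IPC⊢ (a ∧' b ⇒ a)
  ax-∧₂  : ∀ {a b}   → IPC⊢ (a ∧' b ⇒ b)
  ax-∧I  : ∀ {a b}   → IPC⊢ (a ⇒ b ⇒ a ∧' b)
  ax-∨₁  : ∀ {a b}   → IPC⊢ (a ⇒ a ∨' b)
  ax-∨₂  : ∀ {a b}   → IPC⊢ (b ⇒ a ∨' b)
  ax-∨E  : ∀ {a b c} → IPC⊢ ((a ⇒ c) ⇒ (b ⇒ c) ⇒ a ∨' b ⇒ c)
  ax-⊥   : ∀ {a}     → IPC⊢ (⊥' ⇒ a)
  ax-⊤   : IPC⊢ ⊤'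
  mp     : ∀ {a b}   → IPC⊢ (a ⇒ b) → IPC⊢ a → IPC⊢ b

data MFm : Set where
  mvar : ℕ → MFm
  m⊤   : MFm
  m⊥   : MFm
  _m∧_ : MFm → MFm → MFm
  _m∨_ : MFm → MFm → MFm
  _m⇒_ : MFm → MFm → MFm
  □    : MFm → MFm

infixr 6 _m∧_
infixr 5 _m∨_
infixr 4 _m⇒_

emb : Fm → MFm
emb (var x)  = mvar x
emb ⊤'       = m⊤
emb ⊥'       = m⊥
emb (a ∧' b) = emb a m∧ emb b
emb (a ∨' b) = emb a m∨ emb b
emb (a ⇒ b)  = emb a m⇒ emb b

m∼_ : MFm → MFm
m∼ χ = χ m⇒ m⊥

data K⊢_ : MFm → Set where
  ax-K   : ∀ {a b}   → K⊢ (a m⇒ b m⇒ a)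
  ax-S   : ∀ {a b c} → K⊢ ((a m⇒ b m⇒ c) m⇒ (a m⇒ b) m⇒ a m⇒ c)
  ax-∧₁  : ∀ {a b}   → K⊢ (a m∧ b m⇒ a)
  ax-∧₂  : ∀ {a b}   → K⊢ (a m∧ b m⇒ b)
  ax-∧I  : ∀ {a b}   → K⊢ (a m⇒ b m⇒ a m∧ b)
  ax-∨₁  : ∀ {a b}   → K⊢ (a m⇒ a m∨ b)
  ax-∨₂  : ∀ {a b}   → K⊢ (b m⇒ a m∨ b)
  ax-∨E  : ∀ {a b c} → K⊢ ((a m⇒ c) m⇒ (b m⇒ c) m⇒ a m∨ b m⇒ c)
  ax-⊥   : ∀ {a}     → K⊢ (m⊥ m⇒ a)
  ax-⊤   : K⊢ m⊤
  ax-DNE : ∀ {a}     → K⊢ ((m∼ (m∼ a)) m⇒ a)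
  ax-□K  : ∀ {a b}   → K⊢ (□ (a m⇒ b) m⇒ □ a m⇒ □ b)
  nec    : ∀ {a}     → K⊢ a → K⊢ □ a
  mp     : ∀ {a b}   → K⊢ (a m⇒ b) → K⊢ a → K⊢ b

⋀ : ∀ {m} → Vec Fm m → Fm
⋀ []       = ⊤'
⋀ (a ∷ []) = a
⋀ (a ∷ as@(_ ∷ _)) = a ∧' ⋀ as

m⋀ : ∀ {m} → Vec MFm m → MFm
m⋀ []       = m⊤
m⋀ (a ∷ []) = a
m⋀ (a ∷ as@(_ ∷ _)) = a m∧ m⋀ as

zipV : ∀ {m} {A B C : Set} → (A → B → C) → Vec A m → Vec B m → Vec C m
zipV f []       []       = []
zipV f (a ∷ as) (b ∷ bs) = f a b ∷ zipV f as bs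

-- Splitting the hypothesis ⋀ᵢ(Aᵢ ∨ Bᵢ) into cases leaves, for every choice of one disjunct per i,
-- a context Γ of literals over p̄ (resp. over p̄, q̄). Because φ → ψ is a tautology whose only
-- shared atoms are p̄, a model of Γ satisfying φ forces ψ in every model of Γ: for (1)/(2) all
-- models of Γ agree on p̄, and for (3)/(4) the values φ(¬p̄) reads off one model lie below the
-- values ψ(q̄) reads off another, which suffices when φ or ψ is monotone in p̄. Hence either no
-- model of Γ satisfies φ or all of them satisfy ψ, and Glivenko's theorem (via Kalmár's lemma)
-- gives Γ ⊢ ¬φ or Γ ⊢ ¬¬ψ in IPC. In K, ¬¬ψ yields ψ and necessitation turns a derivation
-- from Γ into one of □¬φ or □ψ from □Γ.

{-# OPTIONS --safe #-}
module Submission where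

open import Defs
open import Data.Nat using (ℕ; _≟_)
open import Data.Bool using (Bool; true; false; not; if_then_else_; _∧_; _∨_; T)
import Data.Bool.Properties as Bool
open import Algebra.Lattice.Properties.BooleanAlgebra Bool.∨-∧-booleanAlgebra using (deMorgan₁; deMorgan₂)
open import Data.Empty using (⊥)
open import Data.List as List using (List; []; _∷_; _++_; concatMap)
open import Data.List.Membership.Propositional using (_∈_; find)
open import Data.List.Membership.Propositional.Properties using (∈-++⁺ˡ; ∈-++⁺ʳ; ∈-map⁺; ∈-concat⁺′)
open import Data.List.Membership.DecPropositional _≟_ using (_∈?_)
open import Data.List.Relation.Binary.Subset.Propositional using (_⊆_)
open import Data.List.Relation.Unary.All using (All; []; _∷_; all?)
open import Data.List.Relation.Unary.All.Properties using (¬All⇒Any¬)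
open import Data.List.Relation.Unary.Any using (here; there)
open import Data.Product as Product using (_×_; _,_; proj₁; proj₂; ∃; ∃-syntax)
open import Data.Sum as Sum using (_⊎_; inj₁; inj₂; [_,_])
open import Data.Vec using (Vec; []; _∷_; map)
open import Data.Vec.Membership.Propositional using () renaming (_∈_ to _∈ᵥ_)
open import Data.Vec.Membership.DecPropositional _≟_ using () renaming (_∈?_ to _∈ᵥ?_)
import Data.Vec.Relation.Unary.Any as Vecᴬ
open import Data.Vec.Relation.Unary.Unique.Propositional using (Unique)
open import Function using (_∘_; id)
open import Function.Bundles using (module Equivalence)
open Equivalence using (to; from)
open import Relation.Binary.PropositionalEquality using (_≡_; _≢_; refl; sym; trans; cong; cong₂; subst)
open import Relation.Nullary using (¬_; Dec; yes; no; does; contradiction)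
open import Relation.Nullary.Decidable using (dec-true; dec-false)
open import Relation.Unary using (Decidable)

select : ∀ {X Y : Set} {m} → (X → Y) → (X → Y) → Vec X m → Vec Bool m → List Y
select A B []       []       = []
select A B (x ∷ xs) (c ∷ cs) = (if c then A x else B x) ∷ select A B xs cs

map-select : ∀ {X Y Z : Set} {m} (f : Y → Z) (A B : X → Y) (xs : Vec X m) cs
  → List.map f (select A B xs cs) ≡ select (λ x → f (A x)) (λ x → f (B x)) xs cs
map-select f A B []       []           = refl
map-select f A B (x ∷ xs) (true ∷ cs)  = cong (f (A x) ∷_) (map-select f A B xs cs)
map-select f A B (x ∷ xs) (false ∷ cs) = cong (f (B x) ∷_) (map-select f A B xs cs)

module Hilbert
  {F : Set} (_⇛_ _∧ᶠ_ _∨ᶠ_ : F → F → F) (⊤ᶠ : F) (⊢_ : F → Set)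
  (ax-K  : ∀ {a b} → ⊢ (a ⇛ (b ⇛ a)))
  (ax-S  : ∀ {a b c} → ⊢ ((a ⇛ (b ⇛ c)) ⇛ ((a ⇛ b) ⇛ (a ⇛ c))))
  (ax-∧₁ : ∀ {a b} → ⊢ ((a ∧ᶠ b) ⇛ a))
  (ax-∧₂ : ∀ {a b} → ⊢ ((a ∧ᶠ b) ⇛ b))
  (ax-∨E : ∀ {a b c} → ⊢ ((a ⇛ c) ⇛ ((b ⇛ c) ⇛ ((a ∨ᶠ b) ⇛ c))))
  (ax-⊤  : ⊢ ⊤ᶠ)
  (mp    : ∀ {a b} → ⊢ (a ⇛ b) → ⊢ a → ⊢ b)
  where

  infix 3 _⊢_

  data _⊢_ (Γ : List F) : F → Set where
    hyp : ∀ {a} → a ∈ Γ → Γ ⊢ a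
    thm : ∀ {a} → ⊢ a → Γ ⊢ a
    app : ∀ {a b} → Γ ⊢ (a ⇛ b) → Γ ⊢ a → Γ ⊢ b

  weaken : ∀ {Γ Δ a} → Γ ⊆ Δ → Γ ⊢ a → Δ ⊢ a
  weaken Γ⊆Δ (hyp a∈Γ) = hyp (Γ⊆Δ a∈Γ)
  weaken Γ⊆Δ (thm ⊢a)  = thm ⊢a
  weaken Γ⊆Δ (app d e) = app (weaken Γ⊆Δ d) (weaken Γ⊆Δ e)

  hyp₀ : ∀ {Γ a} → a ∷ Γ ⊢ a
  hyp₀ = hyp (here refl)

  closed : ∀ {a} → [] ⊢ a → ⊢ a
  closed (thm ⊢a)  = ⊢a
  closed (app d e) = mp (closed d) (closed e)

  ⊢-refl : ∀ {a} → ⊢ (a ⇛ a)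
  ⊢-refl {a} = mp (mp (ax-S {a} {a ⇛ a} {a}) ax-K) ax-K

  deduction : ∀ {Γ a b} → a ∷ Γ ⊢ b → Γ ⊢ (a ⇛ b)
  deduction (hyp (here refl)) = thm ⊢-refl
  deduction (hyp (there b∈Γ)) = app (thm ax-K) (hyp b∈Γ)
  deduction (thm ⊢b)          = app (thm ax-K) (thm ⊢b)
  deduction (app d e)         = app (app (thm ax-S) (deduction d)) (deduction e)

  ∨-elim : ∀ {Γ a b c} → Γ ⊢ (a ∨ᶠ b) → a ∷ Γ ⊢ c → b ∷ Γ ⊢ c → Γ ⊢ c
  ∨-elim d e f = app (app (app (thm ax-∨E) (deduction e)) (deduction f)) d

  ⋀ᶠ : ∀ {m} → Vec F m → F
  ⋀ᶠ []                = ⊤ᶠ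
  ⋀ᶠ (a ∷ [])          = a
  ⋀ᶠ (a ∷ as@(_ ∷ _))  = a ∧ᶠ ⋀ᶠ as

  ⋀ᶠ-uncons : ∀ {Γ m a} (as : Vec F m) → Γ ⊢ ⋀ᶠ (a ∷ as) → Γ ⊢ a × Γ ⊢ ⋀ᶠ as
  ⋀ᶠ-uncons []      d = d , thm ax-⊤
  ⋀ᶠ-uncons (_ ∷ _) d = app (thm ax-∧₁) d , app (thm ax-∧₂) d

  cut : ∀ {Γ a b} → a ∷ [] ⊢ b → Γ ⊢ a → Γ ⊢ b
  cut d e = app (weaken (λ ()) (deduction d)) e

  select-elim : ∀ {X : Set} {m G} (A B : X → F) (xs : Vec X m)
    → (∀ cs → select A B xs cs ⊢ G)
    → ⋀ᶠ (map (λ x → A x ∨ᶠ B x) xs) ∷ [] ⊢ G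
  select-elim A B []       cases = weaken (λ ()) (cases [])
  select-elim {G = G} A B (x ∷ xs) cases = ∨-elim head (branch true) (branch false)
    where
    Γ = ⋀ᶠ (map (λ x → A x ∨ᶠ B x) (x ∷ xs)) ∷ []
    head : Γ ⊢ (A x ∨ᶠ B x)
    head = proj₁ (⋀ᶠ-uncons (map (λ x → A x ∨ᶠ B x) xs) hyp₀)
    tail : Γ ⊢ ⋀ᶠ (map (λ x → A x ∨ᶠ B x) xs)
    tail = proj₂ (⋀ᶠ-uncons (map (λ x → A x ∨ᶠ B x) xs) hyp₀)
    branch : ∀ b → (if b then A x else B x) ∷ Γ ⊢ G
    branch b = app (weaken there (cut (select-elim A B xs λ cs → deduction (cases (b ∷ cs))) tail))
                   hyp₀

module IPC = Hilbert _⇒_ _∧'_ _∨'_ ⊤' IPC⊢_ ax-K ax-S ax-∧₁ ax-∧₂ ax-∨E ax-⊤ mp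
module K = Hilbert _m⇒_ _m∧_ _m∨_ m⊤ K⊢_ ax-K ax-S ax-∧₁ ax-∧₂ ax-∨E ax-⊤ mp

⋀ᶠ≡⋀ : ∀ {m} (as : Vec Fm m) → IPC.⋀ᶠ as ≡ ⋀ as
⋀ᶠ≡⋀ []               = refl
⋀ᶠ≡⋀ (a ∷ [])         = refl
⋀ᶠ≡⋀ (a ∷ as@(_ ∷ _)) = cong (a ∧'_) (⋀ᶠ≡⋀ as)

⋀ᶠ≡m⋀ : ∀ {m} (as : Vec MFm m) → K.⋀ᶠ as ≡ m⋀ as
⋀ᶠ≡m⋀ []               = refl
⋀ᶠ≡m⋀ (a ∷ [])         = refl
⋀ᶠ≡m⋀ (a ∷ as@(_ ∷ _)) = cong (a m∧_) (⋀ᶠ≡m⋀ as)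

Val : Set
Val = ℕ → Bool

_[_≔_] : Val → ℕ → Bool → Val
(v [ a ≔ b ]) x with x ≟ a
... | yes _ = b
... | no  _ = v x

update-self : ∀ v {a b} → v a ≡ b → ∀ x → (v [ a ≔ b ]) x ≡ v x
update-self v {a} va≡b x with x ≟ a
... | yes refl = sym va≡b
... | no  _    = refl

update-cong : ∀ {u v} a b {A} → (∀ x → x ∈ A → u x ≡ v x)
  → ∀ x → x ∈ a ∷ A → (u [ a ≔ b ]) x ≡ (v [ a ≔ b ]) x
update-cong a b agree x x∈ with x ≟ a | x∈
... | yes _   | _         = refl
... | no x≢a  | here x≡a  = contradiction x≡a x≢a
... | no _    | there x∈A = agree x x∈A

mix : ∀ {P : ℕ → Set} → Decidable P → Val → Val → Val
mix P? u v x = if does (P? x) then u x else v x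

mix-in : ∀ {P : ℕ → Set} (P? : Decidable P) u v {x} → P x → mix P? u v x ≡ u x
mix-in P? u v {x} px = cong (if_then u x else v x) (dec-true (P? x) px)

mix-out : ∀ {P : ℕ → Set} (P? : Decidable P) u v {x} → ¬ P x → mix P? u v x ≡ v x
mix-out P? u v {x} ¬px = cong (if_then u x else v x) (dec-false (P? x) ¬px)

eval-cong : ∀ {u v} χ → (∀ x → x ∈ atoms χ → u x ≡ v x) → eval u χ ≡ eval v χ
eval-cong (var x)  agree = agree x (here refl)
eval-cong ⊤'       agree = refl
eval-cong ⊥'       agree = refl
eval-cong (a ∧' b) agree =
  cong₂ _∧_ (eval-cong a (λ x → agree x ∘ ∈-++⁺ˡ))
            (eval-cong b (λ x → agree x ∘ ∈-++⁺ʳ (atoms a)))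
eval-cong (a ∨' b) agree =
  cong₂ _∨_ (eval-cong a (λ x → agree x ∘ ∈-++⁺ˡ))
            (eval-cong b (λ x → agree x ∘ ∈-++⁺ʳ (atoms a)))
eval-cong (a ⇒ b)  agree =
  cong₂ (λ p q → not p ∨ q) (eval-cong a (λ x → agree x ∘ ∈-++⁺ˡ))
                            (eval-cong b (λ x → agree x ∘ ∈-++⁺ʳ (atoms a)))

eval-sub : ∀ σ v χ → eval v (sub σ χ) ≡ eval (λ x → eval v (σ x)) χ
eval-sub σ v (var x)  = refl
eval-sub σ v ⊤'       = refl
eval-sub σ v ⊥'       = refl
eval-sub σ v (a ∧' b) = cong₂ _∧_ (eval-sub σ v a) (eval-sub σ v b)
eval-sub σ v (a ∨' b) = cong₂ _∨_ (eval-sub σ v a) (eval-sub σ v b)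
eval-sub σ v (a ⇒ b)  = cong₂ (λ p q → not p ∨ q) (eval-sub σ v a) (eval-sub σ v b)

eval-∼ : ∀ v χ → eval v (∼ χ) ≡ not (eval v χ)
eval-∼ v χ = Bool.∨-identityʳ (not (eval v χ))

eval-∼-true : ∀ v χ → eval v (∼ χ) ≡ true → eval v χ ≡ false
eval-∼-true v χ v¬χ = Bool.not-injective (trans (sym (eval-∼ v χ)) v¬χ)

_⊨_ : Val → List Fm → Set
v ⊨ Γ = All (λ γ → eval v γ ≡ true) Γ

⊨-cong : ∀ {u v} Γ → (∀ x → x ∈ concatMap atoms Γ → u x ≡ v x) → u ⊨ Γ → v ⊨ Γ
⊨-cong []      agree []          = []
⊨-cong (γ ∷ Γ) agree (uγ ∷ u⊨Γ) =
    trans (sym (eval-cong γ (λ x → agree x ∘ ∈-++⁺ˡ))) uγ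
  ∷ ⊨-cong Γ (λ x → agree x ∘ ∈-++⁺ʳ (atoms γ)) u⊨Γ

∃-valuation? : (A : List ℕ) {P : Val → Set} → (∀ v → Dec (P v))
  → (∀ {u v} → (∀ x → x ∈ A → u x ≡ v x) → P u → P v) → Dec (∃ P)
∃-valuation? [] P? local with P? (λ _ → false)
... | yes p = yes (_ , p)
... | no ¬p = no λ (v , pv) → ¬p (local (λ _ ()) pv)
∃-valuation? (a ∷ A) {P} P? local
  with ∃-valuation? A (λ v → P? (v [ a ≔ true ])) (local ∘ update-cong a true)
     | ∃-valuation? A (λ v → P? (v [ a ≔ false ])) (local ∘ update-cong a false)
... | yes (_ , p) | _           = yes (_ , p)
... | no _        | yes (_ , p) = yes (_ , p)
... | no ¬t       | no ¬f       = no λ (v , pv) → refuted v (v a) refl pv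
  where
  refuted : ∀ v b → v a ≡ b → P v → ⊥
  refuted v true  va pv = ¬t (v , local (λ x _ → sym (update-self v va x)) pv)
  refuted v false va pv = ¬f (v , local (λ x _ → sym (update-self v va x)) pv)

satisfiable? : (Γ : List Fm) → Dec (∃[ v ] v ⊨ Γ)
satisfiable? Γ = ∃-valuation? (concatMap atoms Γ) (λ v → all? (λ γ → eval v γ Bool.≟ true) Γ) (⊨-cong Γ)

open IPC

signed : Bool → Fm → Fm
signed true  χ = χ
signed false χ = ∼ χ

signed-contradiction : ∀ {Γ} b χ → Γ ⊢ signed b χ → Γ ⊢ signed (not b) χ → Γ ⊢ ⊥'
signed-contradiction true  χ d e = app e d
signed-contradiction false χ d e = app d e

kalmar-∧ : ∀ {Γ a b} c d → Γ ⊢ signed c a → Γ ⊢ signed d b → Γ ⊢ signed (c ∧ d) (a ∧' b)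
kalmar-∧ true  true  ⊢a ⊢b  = app (app (thm ax-∧I) ⊢a) ⊢b
kalmar-∧ true  false _  ⊢¬b = deduction (app (weaken there ⊢¬b) (app (thm ax-∧₂) hyp₀))
kalmar-∧ false _     ⊢¬a _  = deduction (app (weaken there ⊢¬a) (app (thm ax-∧₁) hyp₀))

kalmar-∨ : ∀ {Γ a b} c d → Γ ⊢ signed c a → Γ ⊢ signed d b → Γ ⊢ signed (c ∨ d) (a ∨' b)
kalmar-∨ true  _     ⊢a  _   = app (thm ax-∨₁) ⊢a
kalmar-∨ false true  _   ⊢b  = app (thm ax-∨₂) ⊢b
kalmar-∨ false false ⊢¬a ⊢¬b =
  deduction (∨-elim hyp₀ (app (weaken (there ∘ there) ⊢¬a) hyp₀) (app (weaken (there ∘ there) ⊢¬b) hyp₀))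

kalmar-⇒ : ∀ {Γ a b} c d → Γ ⊢ signed c a → Γ ⊢ signed d b → Γ ⊢ signed (not c ∨ d) (a ⇒ b)
kalmar-⇒ true  true  _   ⊢b  = app (thm ax-K) ⊢b
kalmar-⇒ true  false ⊢a  ⊢¬b = deduction (app (weaken there ⊢¬b) (app hyp₀ (weaken there ⊢a)))
kalmar-⇒ false _     ⊢¬a _   = deduction (app (thm ax-⊥) (app (weaken there ⊢¬a) hyp₀))

kalmar : ∀ {Γ} v χ → (∀ x → x ∈ atoms χ → signed (v x) (var x) ∈ Γ) → Γ ⊢ signed (eval v χ) χ
kalmar v (var x)  lits = hyp (lits x (here refl))
kalmar v ⊤'       lits = thm ax-⊤
kalmar v ⊥'       lits = thm ⊢-refl
kalmar v (a ∧' b) lits = kalmar-∧ (eval v a) (eval v b)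
  (kalmar v a (λ x → lits x ∘ ∈-++⁺ˡ)) (kalmar v b (λ x → lits x ∘ ∈-++⁺ʳ (atoms a)))
kalmar v (a ∨' b) lits = kalmar-∨ (eval v a) (eval v b)
  (kalmar v a (λ x → lits x ∘ ∈-++⁺ˡ)) (kalmar v b (λ x → lits x ∘ ∈-++⁺ʳ (atoms a)))
kalmar v (a ⇒ b)  lits = kalmar-⇒ (eval v a) (eval v b)
  (kalmar v a (λ x → lits x ∘ ∈-++⁺ˡ)) (kalmar v b (λ x → lits x ∘ ∈-++⁺ʳ (atoms a)))

excluded-middle : ∀ {Γ} a → a ∷ Γ ⊢ ⊥' → ∼ a ∷ Γ ⊢ ⊥' → Γ ⊢ ⊥'
excluded-middle a d e = app (deduction e) (deduction d)

atom-cases : ∀ {Γ} (A : List ℕ)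
  → (∀ (v : Val) {Δ} → Γ ⊆ Δ → (∀ x → x ∈ A → signed (v x) (var x) ∈ Δ) → Δ ⊢ ⊥')
  → Γ ⊢ ⊥'
atom-cases []      cases = cases (λ _ → true) id (λ _ ())
atom-cases {Γ} (a ∷ A) cases = excluded-middle (var a) (case true) (case false)
  where
  case : ∀ b → signed b (var a) ∷ Γ ⊢ ⊥'
  case b = atom-cases A λ v ext lits → cases (v [ a ≔ b ]) (ext ∘ there) (lits′ v ext lits)
    where
    lits′ : ∀ (v : Val) {Δ} → signed b (var a) ∷ Γ ⊆ Δ → (∀ x → x ∈ A → signed (v x) (var x) ∈ Δ)
      → ∀ x → x ∈ a ∷ A → signed ((v [ a ≔ b ]) x) (var x) ∈ Δ
    lits′ v ext lits x x∈ with x ≟ a | x∈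
    ... | yes refl | _         = ext (here refl)
    ... | no x≢a   | here x≡a  = contradiction x≡a x≢a
    ... | no _     | there x∈A = lits x x∈A

atoms-∈ : ∀ {Γ γ x} → γ ∈ Γ → x ∈ atoms γ → x ∈ concatMap atoms Γ
atoms-∈ γ∈Γ x∈γ = ∈-concat⁺′ x∈γ (∈-map⁺ atoms γ∈Γ)

-- For b = true the conclusion is Γ ⊢ ¬¬χ, for b = false it is Γ ⊢ ¬χ.
glivenko : ∀ {Γ χ} b → (∀ v → v ⊨ Γ → eval v χ ≡ b) → Γ ⊢ ∼ signed (not b) χ
glivenko {Γ} {χ} b valid = deduction (atom-cases (atoms χ ++ concatMap atoms Γ) refute)
  where
  refute : ∀ (v : Val) {Δ} → signed (not b) χ ∷ Γ ⊆ Δ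
    → (∀ x → x ∈ atoms χ ++ concatMap atoms Γ → signed (v x) (var x) ∈ Δ) → Δ ⊢ ⊥'
  refute v {Δ} ext lits with all? (λ γ → eval v γ Bool.≟ true) Γ
  ... | yes v⊨Γ = signed-contradiction b χ
          (subst (λ c → Δ ⊢ signed c χ) (valid v v⊨Γ) (kalmar v χ (λ x → lits x ∘ ∈-++⁺ˡ)))
          (hyp (ext (here refl)))
  ... | no v⊭Γ with find (¬All⇒Any¬ (λ γ → eval v γ Bool.≟ true) Γ v⊭Γ)
  ...   | γ , γ∈Γ , γ-false = signed-contradiction true γ
          (hyp (ext (there γ∈Γ)))
          (subst (λ c → Δ ⊢ signed c γ) (Bool.¬-not γ-false)
            (kalmar v γ (λ x → lits x ∘ ∈-++⁺ʳ (atoms χ) ∘ atoms-∈ γ∈Γ)))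

dichotomy : ∀ {Γ α β} → (∀ u w → u ⊨ Γ → w ⊨ Γ → eval u α ≡ true → eval w β ≡ true)
  → Γ ⊢ ∼ α ⊎ Γ ⊢ ∼ ∼ β
dichotomy {Γ} {α} transfer with satisfiable? (α ∷ Γ)
... | yes (u , uα ∷ u⊨Γ) = inj₂ (glivenko true λ w w⊨Γ → transfer u w u⊨Γ w⊨Γ uα)
... | no unsat            = inj₁ (glivenko false λ v v⊨Γ → Bool.¬-not λ vα → unsat (v , vα ∷ v⊨Γ))

emb-theorem : ∀ {a} → IPC⊢ a → K⊢ emb a
emb-theorem ax-K     = ax-K
emb-theorem ax-S     = ax-S
emb-theorem ax-∧₁    = ax-∧₁
emb-theorem ax-∧₂    = ax-∧₂
emb-theorem ax-∧I    = ax-∧I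
emb-theorem ax-∨₁    = ax-∨₁
emb-theorem ax-∨₂    = ax-∨₂
emb-theorem ax-∨E    = ax-∨E
emb-theorem ax-⊥     = ax-⊥
emb-theorem ax-⊤     = ax-⊤
emb-theorem (mp d e) = mp (emb-theorem d) (emb-theorem e)

emb-derivation : ∀ {Γ χ} → Γ ⊢ χ → List.map emb Γ K.⊢ emb χ
emb-derivation (hyp χ∈Γ) = K.hyp (∈-map⁺ emb χ∈Γ)
emb-derivation (thm ⊢χ)  = K.thm (emb-theorem ⊢χ)
emb-derivation (app d e) = K.app (emb-derivation d) (emb-derivation e)

box : ∀ {Γ χ} → Γ K.⊢ χ → List.map □ Γ K.⊢ □ χ
box {[]}    d = K.thm (nec (K.closed d))
box {γ ∷ Γ} d = K.app (K.app (K.thm ax-□K) (K.weaken there (box (K.deduction d)))) K.hyp₀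

from-choices : ∀ {X : Set} {m} (A B : X → Fm) (xs : Vec X m) (α β : Fm)
  → (∀ cs u w → u ⊨ select A B xs cs → w ⊨ select A B xs cs → eval u α ≡ true → eval w β ≡ true)
  → IPC⊢ (⋀ (map (λ x → A x ∨' B x) xs) ⇒ (∼ α ∨' ∼ ∼ β))
  × K⊢ (m⋀ (map (λ x → □ (emb (A x)) m∨ □ (emb (B x))) xs) m⇒ (□ (m∼ emb α) m∨ □ (emb β)))
from-choices A B xs α β transfer = ipc , k
  where
  cases : ∀ cs → select A B xs cs ⊢ ∼ α ⊎ select A B xs cs ⊢ ∼ ∼ β
  cases cs = dichotomy (transfer cs)

  ipc : IPC⊢ (⋀ (map (λ x → A x ∨' B x) xs) ⇒ (∼ α ∨' ∼ ∼ β))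
  ipc rewrite sym (⋀ᶠ≡⋀ (map (λ x → A x ∨' B x) xs)) =
    closed (deduction (select-elim A B xs λ cs → [ app (thm ax-∨₁) , app (thm ax-∨₂) ] (cases cs)))

  boxed-cases : ∀ cs → select (λ x → □ (emb (A x))) (λ x → □ (emb (B x))) xs cs
                       K.⊢ (□ (m∼ emb α) m∨ □ (emb β))
  boxed-cases cs
    rewrite sym (map-select □ (emb ∘ A) (emb ∘ B) xs cs) | sym (map-select emb A B xs cs) =
    [ (λ ⊢¬α → K.app (K.thm ax-∨₁) (box (emb-derivation ⊢¬α)))
    , (λ ⊢¬¬β → K.app (K.thm ax-∨₂) (box (K.app (K.thm ax-DNE) (emb-derivation ⊢¬¬β))))
    ] (cases cs)

  k : K⊢ (m⋀ (map (λ x → □ (emb (A x)) m∨ □ (emb (B x))) xs) m⇒ (□ (m∼ emb α) m∨ □ (emb β)))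
  k rewrite sym (⋀ᶠ≡m⋀ (map (λ x → □ (emb (A x)) m∨ □ (emb (B x))) xs)) =
    K.closed (K.deduction (K.select-elim (λ x → □ (emb (A x))) (λ x → □ (emb (B x))) xs boxed-cases))

map-zipV : ∀ {A B C : Set} {m} (f : A × B → C) (as : Vec A m) bs
  → map f (zipV _,_ as bs) ≡ zipV (λ a b → f (a , b)) as bs
map-zipV f []       []       = refl
map-zipV f (a ∷ as) (b ∷ bs) = cong (f (a , b) ∷_) (map-zipV f as bs)

from-paired-choices : ∀ {m} (ps qs : Vec ℕ m) (α β : Fm)
  → (∀ cs u w → u ⊨ select (var ∘ proj₁) (var ∘ proj₂) (zipV _,_ ps qs) cs
              → w ⊨ select (var ∘ proj₁) (var ∘ proj₂) (zipV _,_ ps qs) cs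
              → eval u α ≡ true → eval w β ≡ true)
  → IPC⊢ (⋀ (zipV (λ p q → var p ∨' var q) ps qs) ⇒ (∼ α ∨' ∼ ∼ β))
  × K⊢ (m⋀ (zipV (λ p q → □ (mvar p) m∨ □ (mvar q)) ps qs) m⇒ (□ (m∼ emb α) m∨ □ (emb β)))
from-paired-choices ps qs α β transfer =
  Product.map (subst (λ c → IPC⊢ (⋀ c ⇒ (∼ α ∨' ∼ ∼ β))) (map-zipV _ ps qs))
              (subst (λ c → K⊢ (m⋀ c m⇒ (□ (m∼ emb α) m∨ □ (emb β)))) (map-zipV _ ps qs))
    (from-choices (var ∘ proj₁) (var ∘ proj₂) (zipV _,_ ps qs) α β transfer)

evalₙ : Val → NNF → Bool
evalₙ v (pos x)  = v x
evalₙ v (neg x)  = not (v x)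
evalₙ v ⊤ₙ       = true
evalₙ v ⊥ₙ       = false
evalₙ v (a ∧ₙ b) = evalₙ v a ∧ evalₙ v b
evalₙ v (a ∨ₙ b) = evalₙ v a ∨ evalₙ v b

evalₙ-nnf⁺ : ∀ v χ → evalₙ v (nnf true χ) ≡ eval v χ
evalₙ-nnf⁻ : ∀ v χ → evalₙ v (nnf false χ) ≡ not (eval v χ)
evalₙ-nnf⁺ v (var x)  = refl
evalₙ-nnf⁺ v ⊤'       = refl
evalₙ-nnf⁺ v ⊥'       = refl
evalₙ-nnf⁺ v (a ∧' b) = cong₂ _∧_ (evalₙ-nnf⁺ v a) (evalₙ-nnf⁺ v b)
evalₙ-nnf⁺ v (a ∨' b) = cong₂ _∨_ (evalₙ-nnf⁺ v a) (evalₙ-nnf⁺ v b)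
evalₙ-nnf⁺ v (a ⇒ b)  = cong₂ _∨_ (evalₙ-nnf⁻ v a) (evalₙ-nnf⁺ v b)
evalₙ-nnf⁻ v (var x)  = refl
evalₙ-nnf⁻ v ⊤'       = refl
evalₙ-nnf⁻ v ⊥'       = refl
evalₙ-nnf⁻ v (a ∧' b) =
  trans (cong₂ _∨_ (evalₙ-nnf⁻ v a) (evalₙ-nnf⁻ v b)) (sym (deMorgan₁ (eval v a) (eval v b)))
evalₙ-nnf⁻ v (a ∨' b) =
  trans (cong₂ _∧_ (evalₙ-nnf⁻ v a) (evalₙ-nnf⁻ v b)) (sym (deMorgan₂ (eval v a) (eval v b)))
evalₙ-nnf⁻ v (a ⇒ b)  =
  trans (cong₂ _∧_ (trans (evalₙ-nnf⁺ v a) (sym (Bool.not-involutive (eval v a)))) (evalₙ-nnf⁻ v b))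
        (sym (deMorgan₂ (not (eval v a)) (eval v b)))

evalₙ-mono : ∀ {u w} n → (∀ x → T (u x) → T (w x)) → (∀ x → NegOcc x n → u x ≡ w x)
  → T (evalₙ u n) → T (evalₙ w n)
evalₙ-mono (pos x)  up _  = up x
evalₙ-mono (neg x)  _  eq = subst (T ∘ not) (eq x here)
evalₙ-mono ⊤ₙ       _  _  = id
evalₙ-mono ⊥ₙ       _  _  = id
evalₙ-mono (a ∧ₙ b) up eq =
  from Bool.T-∧
  ∘ Product.map (evalₙ-mono a up (λ x → eq x ∘ ∧ˡ)) (evalₙ-mono b up (λ x → eq x ∘ ∧ʳ))
  ∘ to Bool.T-∧
evalₙ-mono (a ∨ₙ b) up eq =
  from Bool.T-∨
  ∘ Sum.map (evalₙ-mono a up (λ x → eq x ∘ ∨ˡ)) (evalₙ-mono b up (λ x → eq x ∘ ∨ʳ))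
  ∘ to Bool.T-∨

_≗[_]_ : ∀ {m} → Val → Vec ℕ m → Val → Set
u ≗[ P ] w = ∀ x → x ∈ᵥ P → u x ≡ w x

_≤[_]_ : ∀ {m} → Val → Vec ℕ m → Val → Set
u ≤[ P ] w = ∀ x → x ∈ᵥ P → u x ≡ true → w x ≡ true

eval-monotone : ∀ {m u w} {P : Vec ℕ m} χ → Monotone P χ → u ≤[ P ] w → (∀ x → ¬ x ∈ᵥ P → u x ≡ w x)
  → eval u χ ≡ true → eval w χ ≡ true
eval-monotone {u = u} {w} {P} χ mono u≤w u≡w =
    to Bool.T-≡ ∘ subst T (evalₙ-nnf⁺ w χ)
  ∘ evalₙ-mono (nnf true χ) up eq
  ∘ subst T (sym (evalₙ-nnf⁺ u χ)) ∘ from Bool.T-≡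
  where
  up : ∀ x → T (u x) → T (w x)
  up x with x ∈ᵥ? P
  ... | yes x∈P = from Bool.T-≡ ∘ u≤w x x∈P ∘ to Bool.T-≡
  ... | no  x∉P = subst T (u≡w x x∉P)
  eq : ∀ x → NegOcc x (nnf true χ) → u x ≡ w x
  eq x ¬x with x ∈ᵥ? P
  ... | yes x∈P = contradiction ¬x (mono x x∈P)
  ... | no  x∉P = u≡w x x∉P

module Interpolation {m} (ps : Vec ℕ m) (rs ss : List ℕ) (φ ψ : Fm)
  (ps#rs : ∀ x → x ∈ᵥ ps → x ∈ rs → ⊥)
  (rs#ss : ∀ x → x ∈ rs → x ∈ ss → ⊥)
  (φ-atoms : ∀ x → x ∈ atoms φ → x ∈ᵥ ps ⊎ x ∈ rs)
  (ψ-atoms : ∀ x → x ∈ atoms ψ → x ∈ᵥ ps ⊎ x ∈ ss)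
  (taut : Tautology (φ ⇒ ψ))
  where

  interpolate : ∀ {u w} → u ≗[ ps ] w → eval u φ ≡ true → eval w ψ ≡ true
  interpolate {u} {w} u≗w uφ =
    trans (sym (eval-cong ψ z≗w)) (subst (λ c → not c ∨ eval z ψ ≡ true) zφ (taut z))
    where
    z = mix (_∈? rs) u w
    z≗u : ∀ x → x ∈ atoms φ → z x ≡ u x
    z≗u x x∈φ with φ-atoms x x∈φ
    ... | inj₁ x∈ps = trans (mix-out (_∈? rs) u w (ps#rs x x∈ps)) (sym (u≗w x x∈ps))
    ... | inj₂ x∈rs = mix-in (_∈? rs) u w x∈rs
    z≗w : ∀ x → x ∈ atoms ψ → z x ≡ w x
    z≗w x x∈ψ with ψ-atoms x x∈ψ
    ... | inj₁ x∈ps = mix-out (_∈? rs) u w (ps#rs x x∈ps)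
    ... | inj₂ x∈ss = mix-out (_∈? rs) u w (λ x∈rs → rs#ss x x∈rs x∈ss)
    zφ : eval z φ ≡ true
    zφ = trans (eval-cong φ z≗u) uφ

  interpolate-monotone : Monotone ps φ ⊎ Monotone ps ψ → ∀ {u w} → u ≤[ ps ] w
    → eval u φ ≡ true → eval w ψ ≡ true
  interpolate-monotone (inj₁ φ-mono) {u} {w} u≤w =
    interpolate (λ x x∈ps → mix-in (_∈ᵥ? ps) w u x∈ps)
    ∘ eval-monotone φ φ-mono (λ x x∈ps ux → trans (mix-in (_∈ᵥ? ps) w u x∈ps) (u≤w x x∈ps ux))
                             (λ x x∉ps → sym (mix-out (_∈ᵥ? ps) w u x∉ps))
  interpolate-monotone (inj₂ ψ-mono) {u} {w} u≤w =
    eval-monotone ψ ψ-mono (λ x x∈ps zx → u≤w x x∈ps (trans (sym (mix-in (_∈ᵥ? ps) u w x∈ps)) zx))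
                           (λ x x∉ps → mix-out (_∈ᵥ? ps) u w x∉ps)
    ∘ interpolate (λ x x∈ps → sym (mix-in (_∈ᵥ? ps) u w x∈ps))

choices-agree : ∀ {m u w} (ps : Vec ℕ m) cs
  → u ⊨ select var (λ p → ∼ var p) ps cs → w ⊨ select var (λ p → ∼ var p) ps cs → u ≗[ ps ] w
choices-agree (p ∷ ps) (true  ∷ cs) (up ∷ _) (wp ∷ _) _ (Vecᴬ.here refl) = trans up (sym wp)
choices-agree {u = u} {w} (p ∷ ps) (false ∷ cs) (u¬p ∷ _) (w¬p ∷ _) _ (Vecᴬ.here refl) =
  trans (eval-∼-true u (var p) u¬p) (sym (eval-∼-true w (var p) w¬p))
choices-agree (p ∷ ps) (c ∷ cs) (_ ∷ u⊨) (_ ∷ w⊨) x (Vecᴬ.there x∈ps) = choices-agree ps cs u⊨ w⊨ x x∈ps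

assign-≡ : ∀ {m} p χ (ps : Vec ℕ m) χs → assign (p ∷ ps) (χ ∷ χs) p ≡ χ
assign-≡ p χ ps χs = cong (if_then χ else assign ps χs p) (dec-true (p ≟ p) refl)

assign-≢ : ∀ {m x} p χ (ps : Vec ℕ m) χs → x ≢ p → assign (p ∷ ps) (χ ∷ χs) x ≡ assign ps χs x
assign-≢ {x = x} p χ ps χs x≢p = cong (if_then χ else assign ps χs x) (dec-false (x ≟ p) x≢p)

-- By eval-sub, the two valuations are the ones φ reads in φ(¬p̄) under u and ψ reads in ψ(q̄) under w.
choices-below : ∀ {m u w} (ps qs : Vec ℕ m) cs
  → u ⊨ select (var ∘ proj₁) (var ∘ proj₂) (zipV _,_ ps qs) cs
  → w ⊨ select (var ∘ proj₁) (var ∘ proj₂) (zipV _,_ ps qs) cs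
  → (λ x → eval u (assign ps (map (λ p → ∼ var p) ps) x))
    ≤[ ps ] (λ x → eval w (assign ps (map var qs) x))
choices-below {u = u} {w} (p ∷ ps) (q ∷ qs) (c ∷ cs) (u⊨c ∷ u⊨) (w⊨c ∷ w⊨) x x∈ with x ≟ p | x∈
... | yes refl | _
  rewrite assign-≡ p (∼ var p) ps (map (λ p → ∼ var p) ps) | assign-≡ p (var q) ps (map var qs)
  = chosen c u⊨c w⊨c
  where
  chosen : ∀ c → eval u (if c then var p else var q) ≡ true → eval w (if c then var p else var q) ≡ true
    → eval u (∼ var p) ≡ true → w q ≡ true
  chosen true  up _  u¬p = contradiction (trans (sym up) (eval-∼-true u (var p) u¬p)) λ ()
  chosen false _  wq _   = wq
... | no x≢p | Vecᴬ.here x≡p = contradiction x≡p x≢p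
... | no x≢p | Vecᴬ.there x∈ps
  rewrite assign-≢ p (∼ var p) ps (map (λ p → ∼ var p) ps) x≢p | assign-≢ p (var q) ps (map var qs) x≢p
  = choices-below ps qs cs u⊨ w⊨ x x∈ps

theorem5p11 : ∀ {m} (ps : Vec ℕ m) (rs ss : List ℕ) (φ ψ : Fm)
    → Unique ps
    → (∀ x → x ∈ᵥ ps → x ∈ rs → ⊥)
    → (∀ x → x ∈ᵥ ps → x ∈ ss → ⊥)
    → (∀ x → x ∈ rs → x ∈ ss → ⊥)
    → (∀ x → x ∈ atoms φ → x ∈ᵥ ps ⊎ x ∈ rs)
    → (∀ x → x ∈ atoms ψ → x ∈ᵥ ps ⊎ x ∈ ss)
    → Tautology (φ ⇒ ψ)
    → ((IPC⊢ (⋀ (map (λ p → var p ∨' ∼ var p) ps) ⇒ (∼ φ ∨' ∼ ∼ ψ)))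
       × (K⊢ (m⋀ (map (λ p → □ (mvar p) m∨ □ (m∼ mvar p)) ps)
                m⇒ (□ (m∼ emb φ) m∨ □ (emb ψ)))))
      × ((Monotone ps φ ⊎ Monotone ps ψ)
         → (qs : Vec ℕ m)
         → Unique qs
         → (∀ x → x ∈ᵥ qs → x ∈ᵥ ps → ⊥)
         → (∀ x → x ∈ᵥ qs → x ∈ rs → ⊥)
         → (∀ x → x ∈ᵥ qs → x ∈ ss → ⊥)
         → (IPC⊢ (⋀ (zipV (λ p q → var p ∨' var q) ps qs)
                   ⇒ (∼ negSub ps φ ∨' ∼ ∼ renSub ps qs ψ)))
           × (K⊢ (m⋀ (zipV (λ p q → □ (mvar p) m∨ □ (mvar q)) ps qs)
                   m⇒ (□ (m∼ emb (negSub ps φ)) m∨ □ (emb (renSub ps qs ψ))))))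
-- Repetitions in p̄ or q̄ only repeat conjuncts, and ψ(q̄) is only ever evaluated through the
-- substitution.
theorem5p11 ps rs ss φ ψ _ ps#rs _ rs#ss φ-atoms ψ-atoms taut =
    from-choices var (λ p → ∼ var p) ps φ ψ
      (λ cs _ _ u⊨ w⊨ → interpolate (choices-agree ps cs u⊨ w⊨))
  , λ mono qs _ _ _ _ →
      from-paired-choices ps qs (negSub ps φ) (renSub ps qs ψ) λ cs u w u⊨ w⊨ uφ¬ →
        trans (eval-sub _ w ψ)
          (interpolate-monotone mono (choices-below ps qs cs u⊨ w⊨) (trans (sym (eval-sub _ u φ)) uφ¬))
  where open Interpolation ps rs ss φ ψ ps#rs rs#ss φ-atoms ψ-atoms taut
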